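{- Let $L$ be a finite lattice whose height equals its number of atoms, $\mathrm{ht}(L)=|\mathrm{At}(L)|$. Then the following are equivalent: (i) $L\cong\mathrm{Fl}\,\mathcal{H}$ for some boolean representable simplicial complex $\mathcal{H}$; (ii) $L$ is isomorphic to the lattice $(2^{\mathrm{At}(L)},\subseteq)$ of all subsets of $\mathrm{At}(L)$.
   Context: The height $\mathrm{ht}(L)$ of a finite lattice is the maximal length $n$ of a chain $x_0<x_1<\cdots<x_n$ in $L$; $\mathrm{At}(L)$ is the set of atoms (elements covering the bottom). A (finite) simplicial complex is a pair $\mathcal{H}=(V,H)$ with $V$ finite nonempty and $H\subseteq 2^V$ nonempty and closed under subsets. A subset $X\subseteq V$ is a flat if for every $I\in H$ with $I\subseteq X$ and every $p\in V\setminus X$ we have $I\cup\{p\}\in H$; flats ordered by inclusion form the lattice $\mathrm{Fl}\,\mathcal{H}$. A set $X$ is a transversal of the successive differences for a chain of subsets $A_0\subset\cdots\subset A_k$ if $X$ has an enumeration $x_1,\dots,x_k$ with $x_i\in A_i\setminus A_{i-1}$; $\mathcal{H}$ is boolean representable if every $X\in H$ is such a transversal for some chain in $\mathrm{Fl}\,\mathcal{H}$. -}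

module Defs where

open import Level using (0ℓ)
open import Data.Nat using (ℕ; suc)
import Data.Nat as ℕ
open import Data.Fin using (Fin; inject₁)
open import Data.Fin.Subset using (Subset; _∈_; _∉_; _⊆_; _⊂_; ⁅_⁆; _∪_; ∣_∣)
open import Data.Product using (Σ; ∃; _×_; _,_)
open import Data.Sum using (_⊎_)
open import Relation.Binary.Core using (Rel)
open import Relation.Binary.PropositionalEquality using (_≡_; _≢_)
open import Relation.Nullary using (¬_)
open import Algebra.Core using (Op₂)
open import Relation.Binary.Lattice.Structures using (IsLattice)
open import Function.Bundles using (_⇔_)

record FinLattice (m : ℕ) : Set₁ where
  field
    _≤_       : Rel (Fin m) 0ℓ
    _∨_       : Op₂ (Fin m)
    _∧_       : Op₂ (Fin m)
    isLattice : IsLattice _≡_ _≤_ _∨_ _∧_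

  _<_ : Rel (Fin m) 0ℓ
  x < y = (x ≤ y) × (x ≢ y)

  IsChain : (k : ℕ) → (Fin (suc k) → Fin m) → Set
  IsChain k c = ∀ (i : Fin k) → c (inject₁ i) < c (Fin.suc i)

  Height : ℕ → Set
  Height h = (∃ λ c → IsChain h c) × (∀ k c → IsChain k c → k ℕ.≤ h)

  IsBottom : Fin m → Set
  IsBottom b = ∀ y → b ≤ y

  IsAtom : Fin m → Set
  IsAtom a = ¬ IsBottom a × (∀ z → z ≤ a → z ≡ a ⊎ IsBottom z)

  IsAtomSet : Subset m → Set
  IsAtomSet A = ∀ x → (x ∈ A ⇔ IsAtom x)

  NumAtoms : ℕ → Set
  NumAtoms k = ∃ λ A → IsAtomSet A × ∣ A ∣ ≡ k

  IsoToPowersetOfAtoms : Set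
  IsoToPowersetOfAtoms =
    ∃ λ (g : Fin m → Subset m) →
        (∀ x {a} → a ∈ g x → IsAtom a)
      × (∀ (S : Subset m) → (∀ {a} → a ∈ S → IsAtom a) → ∃ λ x → g x ≡ S)
      × (∀ x y → (x ≤ y ⇔ g x ⊆ g y))


record SimplicialComplex (n : ℕ) : Set₁ where
  field
    H           : Subset (suc n) → Set
    nonempty    : ∃ λ I → H I
    downClosed  : ∀ I J → J ⊆ I → H I → H J

  IsFlat : Subset (suc n) → Set
  IsFlat X = ∀ I → H I → I ⊆ X → ∀ p → p ∉ X → H (⁅ p ⁆ ∪ I)

  -- X is a transversal of the successive differences of some chain
  -- A₀ ⊂ A₁ ⊂ ⋯ ⊂ A_k of flats
  TransversalOfFlatChain : Subset (suc n) → Set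
  TransversalOfFlatChain X =
    ∃ λ (k : ℕ) → ∃ λ (A : Fin (suc k) → Subset (suc n)) → ∃ λ (x : Fin k → Fin (suc n)) →
        (∀ i → IsFlat (A i))
      × (∀ (i : Fin k) → A (inject₁ i) ⊂ A (Fin.suc i))
      × (∀ i → x i ∈ X)
      × (∀ p → p ∈ X → ∃ λ i → x i ≡ p)
      × (∀ i → x i ∈ A (Fin.suc i) × x i ∉ A (inject₁ i))

  BooleanRepresentable : Set
  BooleanRepresentable = ∀ X → H X → TransversalOfFlatChain X

IsoToFlats : ∀ {m n} → FinLattice m → SimplicialComplex n → Set
IsoToFlats {m} {n} L 𝓗 =
  ∃ λ (f : Fin m → Subset (suc n)) →
      (∀ x → IsFlat (f x))
    × (∀ X → IsFlat X → ∃ λ x → f x ≡ X)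
    × (∀ x y → (x ≤ y ⇔ f x ⊆ f y))
  where open FinLattice L; open SimplicialComplex 𝓗

IsoToFlatsOfBR : ∀ {m} → FinLattice m → Set₁
IsoToFlatsOfBR L = ∃ λ (n : ℕ) → ∃ λ (𝓗 : SimplicialComplex n) →
  SimplicialComplex.BooleanRepresentable 𝓗 × IsoToFlats L 𝓗

-- (ii) ⇒ (i): keep the atoms of L as free vertices and make every other vertex a loop. The faces
-- are the sets of atoms and the flats are the sets containing all loops, a copy of 2^At(L); a
-- face is a transversal of the chain of flats obtained by adding its points one at a time.
--
-- (i) ⇒ (ii): call two points parallel if they lie in the same flats. In a boolean representable
-- complex no face contains a loop or two distinct parallel points, because points of a transversal
-- entering a chain of flats at different steps are separated by one of its flats. Hence the loops
-- together with one parallel class form a flat, and these flats are exactly the atoms of Fl 𝓗.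
-- A chain of length h = |At(L)| has at each step a point entering it; these h points are pairwise
-- non-parallel, so their classes are h distinct atoms, i.e. all of them. So every step of the chain
-- adds a single parallel class, and a set of pairwise non-parallel non-loops, meeting each step in
-- at most one point, is a face. Consequently the loops together with the points of any set of atoms
-- form a flat, and x ↦ {atoms below x} is an isomorphism onto 2^At(L).

module Submission where

open import Level using (0ℓ)
import Data.Bool.Properties as Bool
open import Data.Nat as ℕ using (ℕ; zero; suc; z≤n; s≤s)
import Data.Nat.Properties as ℕ
open import Data.Nat.Induction using (<-wellFounded)
open import Data.Fin as Fin using (Fin; zero; suc; inject₁; toℕ; fromℕ)
open import Data.Fin.Properties using (all?; any?; ¬∀⟶∃¬; _≟_; <-cmp; 0≢1+n; suc-injective; toℕ-inject₁; ≤fromℕ)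
open import Data.Fin.Induction using (<-weakInduction; <-weakInduction-startingFrom)
open import Data.Fin.Subset renaming (⊥ to ∅)
open import Data.Fin.Subset.Properties
open import Data.Vec.Base using (tabulate; _∷_; here; there)
open import Data.Vec.Properties using (lookup∘tabulate; lookup⇒[]=; []=⇒lookup; ≡-dec)
open import Data.Product using (∃; _×_; _,_; proj₁; proj₂)
open import Data.Sum using (_⊎_; inj₁; inj₂)
open import Data.Empty using (⊥-elim)
open import Function using (_∘_)
open import Function.Bundles using (_⇔_; mk⇔; Equivalence)
import Function.Properties.Equivalence as ⇔
open import Function.Definitions using (Injective)
open import Induction.WellFounded using (Acc; acc)
open import Relation.Binary.PropositionalEquality
open import Relation.Binary.Definitions using (DecidableEquality; tri<; tri≈; tri>)
open import Relation.Nullary using (¬_; Dec; yes; no; does; _×-dec_; _⊎-dec_; _→-dec_; ¬?)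
open import Relation.Nullary.Decidable using (dec-true)
open import Relation.Unary using (Pred; Decidable)
open import Relation.Binary.Lattice.Structures using (IsLattice)
open import Defs

toSubset : ∀ {n} {P : Pred (Fin n) 0ℓ} → Decidable P → Subset n
toSubset P? = tabulate (does ∘ P?)

module _ {n} {P : Pred (Fin n) 0ℓ} (P? : Decidable P) {x : Fin n} where

  ∈-toSubset⁺ : P x → x ∈ toSubset P?
  ∈-toSubset⁺ p = lookup⇒[]= x _ (trans (lookup∘tabulate _ x) (dec-true (P? x) p))

  ∈-toSubset⁻ : x ∈ toSubset P? → P x
  ∈-toSubset⁻ x∈ with P? x | trans (sym (lookup∘tabulate _ x)) ([]=⇒lookup x∈)
  ... | yes p | _  = p
  ... | no  _ | ()

_≟ˢ_ : ∀ {n} → DecidableEquality (Subset n)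
_≟ˢ_ = ≡-dec Bool._≟_

⊈⇒∃∉ : ∀ {n} {p q : Subset n} → ¬ p ⊆ q → ∃ λ x → x ∈ p × x ∉ q
⊈⇒∃∉ {n} {p} {q} p⊈q
  with ¬∀⟶∃¬ n (λ x → x ∈ p → x ∈ q) (λ x → x ∈? p →-dec x ∈? q) (λ p⊆q → p⊈q (p⊆q _))
... | x , x∈p↛x∈q with x ∈? p
...   | yes x∈p = x , x∈p , λ x∈q → x∈p↛x∈q λ _ → x∈q
...   | no  x∉p = ⊥-elim (x∈p↛x∈q (⊥-elim ∘ x∉p))

injective⇒≤∣p∣ : ∀ {k n} {p : Subset n} (ι : Fin k → Fin n) →
  Injective _≡_ _≡_ ι → (∀ i → ι i ∈ p) → k ℕ.≤ ∣ p ∣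
injective⇒≤∣p∣ {zero}  _ _ _ = z≤n
injective⇒≤∣p∣ {suc k} {p = p} ι ι-inj ι∈p =
  ℕ.≤-trans (s≤s (injective⇒≤∣p∣ (ι ∘ suc) (suc-injective ∘ ι-inj) ι∘suc∈p-ι₀))
            (x∈p⇒∣p-x∣<∣p∣ (ι∈p zero))
  where
  ι∘suc∈p-ι₀ : ∀ i → ι (suc i) ∈ p - ι zero
  ι∘suc∈p-ι₀ i = x∈p∧x≢y⇒x∈p-y (ι∈p (suc i)) (λ eq → 0≢1+n (ι-inj (sym eq)))

x∈⁅y⁆∪p⁻ : ∀ {n} {x y : Fin n} (p : Subset n) → x ∈ ⁅ y ⁆ ∪ p → x ≡ y ⊎ x ∈ p
x∈⁅y⁆∪p⁻ {y = y} p x∈ with x∈p∪q⁻ ⁅ y ⁆ p x∈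
... | inj₁ x∈⁅y⁆ = inj₁ (x∈⁅y⁆⇒x≡y y x∈⁅y⁆)
... | inj₂ x∈p   = inj₂ x∈p

x∉p-x : ∀ {n} {x : Fin n} (p : Subset n) → x ∉ p - x
x∉p-x {x = zero}  (_ ∷ p) ()
x∉p-x {x = suc x} (_ ∷ p) (there x∈p-x) = x∉p-x p x∈p-x

Enters : ∀ {n k} → (Fin (suc k) → Subset n) → Fin k → Fin n → Set
Enters A i z = z ∈ A (suc i) × z ∉ A (inject₁ i)

module _ {n k} (A : Fin (suc k) → Subset n) (A-step : ∀ i → A (inject₁ i) ⊆ A (suc i)) where

  chain-mono : ∀ {i j} → i Fin.≤ j → A i ⊆ A j
  chain-mono {i} =
    <-weakInduction-startingFrom (λ j → A i ⊆ A j) ⊆-refl (λ j Ai⊆Aj → ⊆-trans Ai⊆Aj (A-step j))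

  enters-before : ∀ {i j z w} → i Fin.< j → Enters A i z → Enters A j w →
                  z ∈ A (inject₁ j) × w ∉ A (inject₁ j)
  enters-before {i} {j} i<j (z∈ , _) (_ , w∉) =
    chain-mono (subst (suc (toℕ i) ℕ.≤_) (sym (toℕ-inject₁ j)) i<j) z∈ , w∉

record TransversalChain {n} (Base X : Subset n) : Set where
  field
    length  : ℕ
    sets    : Fin (suc length) → Subset n
    points  : Fin length → Fin n
    starts  : sets zero ≡ Base
    ⊇base   : ∀ i → Base ⊆ sets i
    step    : ∀ i → sets (inject₁ i) ⊆ sets (suc i)
    points∈ : ∀ i → points i ∈ X
    covers  : ∀ p → p ∈ X → ∃ λ i → points i ≡ p
    enters  : ∀ i → Enters sets i (points i)

  strict : ∀ i → sets (inject₁ i) ⊂ sets (suc i)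
  strict i = step i , points i , enters i

transversalChain : ∀ {n} (Base X : Subset n) → (∀ {p} → p ∈ X → p ∉ Base) →
  Acc ℕ._<_ ∣ X ∣ → TransversalChain Base X
transversalChain Base X X∉Base (acc smaller) with nonempty? X
... | no X-empty = record
  { length = 0 ; sets = λ _ → Base ; points = λ () ; starts = refl ; ⊇base = λ _ → ⊆-refl
  ; step = λ () ; points∈ = λ () ; covers = λ p p∈X → ⊥-elim (X-empty (p , p∈X)) ; enters = λ () }
... | yes (p , p∈X) = record
  { length = suc length ; sets = sets′ ; points = points′ ; starts = refl ; ⊇base = ⊇base′
  ; step = step′ ; points∈ = points∈′ ; covers = covers′ ; enters = enters′ }
  where
  X-p∉p∪Base : ∀ {q} → q ∈ X - p → q ∉ ⁅ p ⁆ ∪ Base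
  X-p∉p∪Base q∈X-p q∈p∪Base with x∈⁅y⁆∪p⁻ Base q∈p∪Base
  ... | inj₁ refl   = x∉p-x X q∈X-p
  ... | inj₂ q∈Base = X∉Base (p─q⊆p X ⁅ p ⁆ q∈X-p) q∈Base

  open TransversalChain
    (transversalChain (⁅ p ⁆ ∪ Base) (X - p) X-p∉p∪Base (smaller (x∈p⇒∣p-x∣<∣p∣ p∈X)))

  sets′ : Fin (suc (suc length)) → Subset _
  sets′ zero    = Base
  sets′ (suc i) = sets i

  points′ : Fin (suc length) → Fin _
  points′ zero    = p
  points′ (suc i) = points i

  ⊇base′ : ∀ i → Base ⊆ sets′ i
  ⊇base′ zero    = ⊆-refl
  ⊇base′ (suc i) = ⊆-trans (q⊆p∪q ⁅ p ⁆ Base) (⊇base i)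

  p∈sets₀ : p ∈ sets zero
  p∈sets₀ rewrite starts = x∈p∪q⁺ (inj₁ (x∈⁅x⁆ p))

  step′ : ∀ i → sets′ (inject₁ i) ⊆ sets′ (suc i)
  step′ zero    = ⊇base′ (suc zero)
  step′ (suc i) = step i

  points∈′ : ∀ i → points′ i ∈ X
  points∈′ zero    = p∈X
  points∈′ (suc i) = p─q⊆p X ⁅ p ⁆ (points∈ i)

  covers′ : ∀ q → q ∈ X → ∃ λ i → points′ i ≡ q
  covers′ q q∈X with q ≟ p
  ... | yes refl = zero , refl
  ... | no  q≢p  with covers q (x∈p∧x≢y⇒x∈p-y q∈X q≢p)
  ...   | i , pᵢ≡q = suc i , pᵢ≡q

  enters′ : ∀ i → Enters sets′ i (points′ i)
  enters′ zero    = p∈sets₀ , X∉Base p∈X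
  enters′ (suc i) = enters i

module Free {n} (T : Subset (suc n)) where

  free : SimplicialComplex n
  free = record { H = _⊆ T ; nonempty = ∅ , ⊥⊆ ; downClosed = λ _ _ J⊆I I⊆T → ⊆-trans J⊆I I⊆T }

  open SimplicialComplex free

  flat⇒∁⊆ : ∀ {X} → IsFlat X → ∁ T ⊆ X
  flat⇒∁⊆ {X} X-flat {z} z∈∁T with z ∈? X
  ... | yes z∈X = z∈X
  ... | no  z∉X = ⊥-elim (x∈∁p⇒x∉p z∈∁T (X-flat ∅ ⊥⊆ ⊥⊆ z z∉X (x∈p∪q⁺ (inj₁ (x∈⁅x⁆ z)))))

  ∁⊆⇒flat : ∀ {X} → ∁ T ⊆ X → IsFlat X
  ∁⊆⇒flat ∁T⊆X I I⊆T _ p p∉X z∈p∪I with x∈⁅y⁆∪p⁻ I z∈p∪I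
  ... | inj₁ refl = x∉∁p⇒x∈p (p∉X ∘ ∁T⊆X)
  ... | inj₂ z∈I  = I⊆T z∈I

  free-booleanRepresentable : BooleanRepresentable
  free-booleanRepresentable X X⊆T =
    length , sets , points , (λ i → ∁⊆⇒flat (⊇base i)) , strict , points∈ , covers , enters
    where open TransversalChain (transversalChain (∁ T) X (x∈p⇒x∉∁p ∘ X⊆T) (<-wellFounded _))

  ∁∪∩≡ : ∀ {X} → ∁ T ⊆ X → ∁ T ∪ (X ∩ T) ≡ X
  ∁∪∩≡ {X} ∁T⊆X = ⊆-antisym ⊆X X⊆
    where
    ⊆X : ∁ T ∪ (X ∩ T) ⊆ X
    ⊆X z∈ with x∈p∪q⁻ (∁ T) (X ∩ T) z∈
    ... | inj₁ z∈∁T  = ∁T⊆X z∈∁T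
    ... | inj₂ z∈X∩T = proj₁ (x∈p∩q⁻ X T z∈X∩T)
    X⊆ : X ⊆ ∁ T ∪ (X ∩ T)
    X⊆ {z} z∈X with z ∈? T
    ... | yes z∈T = x∈p∪q⁺ (inj₂ (x∈p∩q⁺ (z∈X , z∈T)))
    ... | no  z∉T = x∈p∪q⁺ (inj₁ (x∉p⇒x∈∁p z∉T))

  module _ {m} (L : FinLattice m) (g : Fin m → Subset (suc n)) (g⊆T : ∀ x → g x ⊆ T)
    (g-onto : ∀ S → S ⊆ T → ∃ λ x → g x ≡ S)
    (g-iso : ∀ x y → (FinLattice._≤_ L x y ⇔ g x ⊆ g y)) where

    ⊆⇔∁∪⊆ : ∀ x y → g x ⊆ g y ⇔ ∁ T ∪ g x ⊆ ∁ T ∪ g y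
    ⊆⇔∁∪⊆ x y = mk⇔ to from
      where
      from : ∁ T ∪ g x ⊆ ∁ T ∪ g y → g x ⊆ g y
      from ⊆∪ z∈gx with x∈p∪q⁻ (∁ T) (g y) (⊆∪ (q⊆p∪q (∁ T) (g x) z∈gx))
      ... | inj₁ z∈∁T = ⊥-elim (x∈∁p⇒x∉p z∈∁T (g⊆T x z∈gx))
      ... | inj₂ z∈gy = z∈gy
      to : g x ⊆ g y → ∁ T ∪ g x ⊆ ∁ T ∪ g y
      to gx⊆gy z∈ with x∈p∪q⁻ (∁ T) (g x) z∈
      ... | inj₁ z∈∁T = x∈p∪q⁺ (inj₁ z∈∁T)
      ... | inj₂ z∈gx = x∈p∪q⁺ (inj₂ (gx⊆gy z∈gx))

    free-flats : IsoToFlats L free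
    free-flats = (λ x → ∁ T ∪ g x) , (λ x → ∁⊆⇒flat (p⊆p∪q (g x))) , onto
               , (λ x y → ⇔.trans (g-iso x y) (⊆⇔∁∪⊆ x y))
      where
      onto : ∀ X → IsFlat X → ∃ λ x → ∁ T ∪ g x ≡ X
      onto X X-flat with g-onto (X ∩ T) (p∩q⊆q X T)
      ... | x , gx≡X∩T = x , trans (cong (∁ T ∪_) gx≡X∩T) (∁∪∩≡ (flat⇒∁⊆ X-flat))

powersetOfAtoms⇒flatsOfBR : ∀ {m} (L : FinLattice m) (As : Subset m) → FinLattice.IsAtomSet L As →
  FinLattice.IsoToPowersetOfAtoms L → IsoToFlatsOfBR L
powersetOfAtoms⇒flatsOfBR {m} L As As-atoms (g , g-atoms , g-onto , g-iso) =
  m , free , free-booleanRepresentable , free-flats L g′ g′⊆T g′-onto g′-iso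
  where
  -- vertex suc a is the element a of L, so vertex zero and the non-atoms are loops
  T = outside ∷ As
  open Free T

  g′ : Fin m → Subset (suc m)
  g′ x = outside ∷ g x

  g′⊆T : ∀ x → g′ x ⊆ T
  g′⊆T x = out⊆ (λ a∈gx → Equivalence.from (As-atoms _) (g-atoms x a∈gx))

  g′-onto : ∀ S → S ⊆ T → ∃ λ x → g′ x ≡ S
  g′-onto (inside  ∷ S) S⊆T with S⊆T here
  ... | ()
  g′-onto (outside ∷ S) S⊆T with g-onto S (λ a∈S → Equivalence.to (As-atoms _) (drop-∷-⊆ S⊆T a∈S))
  ... | x , gx≡S = x , cong (outside ∷_) gx≡S

  g′-iso : ∀ x y → (FinLattice._≤_ L x y ⇔ g′ x ⊆ g′ y)
  g′-iso x y = ⇔.trans (g-iso x y) out⊆-⇔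

module Complex {n} (𝓗 : SimplicialComplex n) where
  open SimplicialComplex 𝓗

  ∅-face : H ∅
  ∅-face = downClosed _ ∅ ⊥⊆ (proj₂ nonempty)

  face-along-flat-chain : ∀ {h} (F : Fin (suc h) → Subset (suc n)) → (∀ i → IsFlat (F i)) →
    ∀ X → H (X ∩ F zero) →
    (∀ j {p q} → p ∈ X → q ∈ X → Enters F j p → Enters F j q → p ≡ q) →
    ∀ i → H (X ∩ F i)
  face-along-flat-chain F F-flat X face₀ one-per-step = <-weakInduction (λ i → H (X ∩ F i)) face₀ extend
    where
    extend : ∀ j → H (X ∩ F (inject₁ j)) → H (X ∩ F (suc j))
    extend j face with any? (λ z → z ∈? X ×-dec z ∈? F (suc j) ×-dec ¬? (z ∈? F (inject₁ j)))
    ... | no none = downClosed _ _ old face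
      where
      old : X ∩ F (suc j) ⊆ X ∩ F (inject₁ j)
      old {z} z∈ with x∈p∩q⁻ X _ z∈ | z ∈? F (inject₁ j)
      ... | z∈X , _      | yes z∈Fⱼ = x∈p∩q⁺ (z∈X , z∈Fⱼ)
      ... | z∈X , z∈Fⱼ₊₁ | no  z∉Fⱼ = ⊥-elim (none (z , z∈X , z∈Fⱼ₊₁ , z∉Fⱼ))
    ... | yes (p , p∈X , p-enters) =
      downClosed _ _ at-most-p (F-flat (inject₁ j) _ face (p∩q⊆q X _) p (proj₂ p-enters))
      where
      at-most-p : X ∩ F (suc j) ⊆ ⁅ p ⁆ ∪ (X ∩ F (inject₁ j))
      at-most-p {z} z∈ with x∈p∩q⁻ X _ z∈ | z ∈? F (inject₁ j)
      ... | z∈X , _      | yes z∈Fⱼ = x∈p∪q⁺ (inj₂ (x∈p∩q⁺ (z∈X , z∈Fⱼ)))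
      ... | z∈X , z∈Fⱼ₊₁ | no  z∉Fⱼ
        rewrite one-per-step j z∈X p∈X (z∈Fⱼ₊₁ , z∉Fⱼ) p-enters = x∈p∪q⁺ (inj₁ (x∈⁅x⁆ p))

module EnumeratedFlats {n m} (𝓗 : SimplicialComplex n) (f : Fin m → Subset (suc n))
  (f-flat : ∀ x → SimplicialComplex.IsFlat 𝓗 (f x))
  (f-onto : ∀ X → SimplicialComplex.IsFlat 𝓗 X → ∃ λ x → f x ≡ X) where
  open SimplicialComplex 𝓗
  open Complex 𝓗

  Loop : Pred (Fin (suc n)) 0ℓ
  Loop z = ∀ x → z ∈ f x

  loop? : Decidable Loop
  loop? z = all? (λ x → z ∈? f x)

  loops : Subset (suc n)
  loops = toSubset loop?

  loop∈flat : ∀ {X z} → IsFlat X → Loop z → z ∈ X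
  loop∈flat X-flat z-loop with f-onto _ X-flat
  ... | x , refl = z-loop x

  loops-flat : IsFlat loops
  loops-flat I I-face I⊆loops p p∉loops
    with ¬∀⟶∃¬ m (λ x → p ∈ f x) (λ x → p ∈? f x) (p∉loops ∘ ∈-toSubset⁺ loop?)
  ... | x , p∉fx = f-flat x I I-face (λ z∈I → ∈-toSubset⁻ loop? (I⊆loops z∈I) x) p p∉fx

  singleton-face : ∀ {z} → ¬ Loop z → H ⁅ z ⁆
  singleton-face {z} z-nonloop =
    downClosed _ _ (p⊆p∪q ∅) (loops-flat ∅ ∅-face ⊥⊆ z (z-nonloop ∘ ∈-toSubset⁻ loop?))

  flatsThrough : Fin (suc n) → Subset m
  flatsThrough z = toSubset (λ x → z ∈? f x)

  ∈flatsThrough⁺ : ∀ {z x} → z ∈ f x → x ∈ flatsThrough z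
  ∈flatsThrough⁺ {z} = ∈-toSubset⁺ (λ x → z ∈? f x)

  ∈flatsThrough⁻ : ∀ {z x} → x ∈ flatsThrough z → z ∈ f x
  ∈flatsThrough⁻ {z} = ∈-toSubset⁻ (λ x → z ∈? f x)

  _∥_ : Fin (suc n) → Fin (suc n) → Set
  z ∥ w = flatsThrough z ≡ flatsThrough w

  ∥-flat : ∀ {X z w} → IsFlat X → z ∥ w → z ∈ X → w ∈ X
  ∥-flat X-flat z∥w z∈X with f-onto _ X-flat
  ... | x , refl = ∈flatsThrough⁻ (subst (x ∈_) z∥w (∈flatsThrough⁺ z∈X))

  separated-pair-face : ∀ {z w x} → ¬ Loop w → w ∈ f x → z ∉ f x → H (⁅ z ⁆ ∪ ⁅ w ⁆)
  separated-pair-face {z} {w} {x} w-nonloop w∈fx z∉fx =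
    f-flat x ⁅ w ⁆ (singleton-face w-nonloop) ⁅w⁆⊆fx z z∉fx
    where
    ⁅w⁆⊆fx : ⁅ w ⁆ ⊆ f x
    ⁅w⁆⊆fx u∈⁅w⁆ rewrite x∈⁅y⁆⇒x≡y w u∈⁅w⁆ = w∈fx

  nonparallel-pair-face : ∀ {z w} → ¬ Loop z → ¬ Loop w → ¬ z ∥ w → H (⁅ z ⁆ ∪ ⁅ w ⁆)
  nonparallel-pair-face {z} {w} z-nonloop w-nonloop z∦w with flatsThrough w ⊆? flatsThrough z
  ... | no w⊈z with ⊈⇒∃∉ w⊈z
  ...   | _ , x∈w , x∉z = separated-pair-face w-nonloop (∈flatsThrough⁻ x∈w) (x∉z ∘ ∈flatsThrough⁺)
  nonparallel-pair-face {z} {w} z-nonloop w-nonloop z∦w | yes w⊆z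
    with ⊈⇒∃∉ {p = flatsThrough z} (λ z⊆w → z∦w (⊆-antisym z⊆w w⊆z))
  ...   | _ , x∈z , x∉w = subst H (∪-comm ⁅ w ⁆ ⁅ z ⁆)
    (separated-pair-face z-nonloop (∈flatsThrough⁻ x∈z) (x∉w ∘ ∈flatsThrough⁺))

  parallel-enter-together : ∀ {k} (A : Fin (suc k) → Subset (suc n)) → (∀ i → IsFlat (A i)) →
    (∀ i → A (inject₁ i) ⊆ A (suc i)) →
    ∀ {i j z w} → Enters A i z → Enters A j w → z ∥ w → i ≡ j
  parallel-enter-together A A-flat A-step {i} {j} z-enters w-enters z∥w with <-cmp i j
  ... | tri≈ _ i≡j _ = i≡j
  ... | tri< i<j _ _ = let z∈Aⱼ , w∉Aⱼ = enters-before A A-step i<j z-enters w-enters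
                       in ⊥-elim (w∉Aⱼ (∥-flat (A-flat _) z∥w z∈Aⱼ))
  ... | tri> _ _ j<i = let w∈Aᵢ , z∉Aᵢ = enters-before A A-step j<i w-enters z-enters
                       in ⊥-elim (z∉Aᵢ (∥-flat (A-flat _) (sym z∥w) w∈Aᵢ))

  module BR (br : BooleanRepresentable) where

    loop∉face : ∀ {I z} → H I → z ∈ I → ¬ Loop z
    loop∉face I-face z∈I z-loop with br _ I-face
    ... | _ , A , _ , A-flat , _ , _ , covers , enters with covers _ z∈I
    ...   | i , refl = proj₂ (enters i) (loop∈flat (A-flat (inject₁ i)) z-loop)

    parallel-in-face⇒≡ : ∀ {I z w} → H I → z ∈ I → w ∈ I → z ∥ w → z ≡ w
    parallel-in-face⇒≡ I-face z∈I w∈I z∥w with br _ I-face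
    ... | _ , A , x , A-flat , A-strict , _ , covers , enters with covers _ z∈I | covers _ w∈I
    ...   | i , refl | j , refl =
      cong x (parallel-enter-together A A-flat (proj₁ ∘ A-strict) (enters i) (enters j) z∥w)

    class? : ∀ y z → Dec (Loop z ⊎ z ∥ y)
    class? y z = loop? z ⊎-dec flatsThrough z ≟ˢ flatsThrough y

    class : Fin (suc n) → Subset (suc n)
    class y = toSubset (class? y)

    y∈class : ∀ y → y ∈ class y
    y∈class y = ∈-toSubset⁺ (class? y) (inj₂ refl)

    ∈class⇒∥ : ∀ {y z} → z ∈ class y → ¬ Loop z → z ∥ y
    ∈class⇒∥ {y} z∈class z-nonloop with ∈-toSubset⁻ (class? y) z∈class
    ... | inj₁ z-loop = ⊥-elim (z-nonloop z-loop)
    ... | inj₂ z∥y    = z∥y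

    class-flat : ∀ y → IsFlat (class y)
    class-flat y I I-face I⊆class p p∉class = extend (nonempty? I)
      where
      p-nonloop : ¬ Loop p
      p-nonloop = p∉class ∘ ∈-toSubset⁺ (class? y) ∘ inj₁
      I∥y : ∀ {u} → u ∈ I → u ∥ y
      I∥y u∈I = ∈class⇒∥ {y} (I⊆class u∈I) (loop∉face I-face u∈I)
      extend : Dec (Nonempty I) → H (⁅ p ⁆ ∪ I)
      extend (no I-empty) = downClosed _ _ ⁅p⁆∪I⊆⁅p⁆ (singleton-face p-nonloop)
        where
        ⁅p⁆∪I⊆⁅p⁆ : ⁅ p ⁆ ∪ I ⊆ ⁅ p ⁆
        ⁅p⁆∪I⊆⁅p⁆ {u} u∈ with x∈p∪q⁻ ⁅ p ⁆ I u∈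
        ... | inj₁ u∈⁅p⁆ = u∈⁅p⁆
        ... | inj₂ u∈I   = ⊥-elim (I-empty (u , u∈I))
      extend (yes (w , w∈I)) =
        downClosed _ _ ⁅p⁆∪I⊆⁅p,w⁆ (nonparallel-pair-face p-nonloop (loop∉face I-face w∈I) p∦w)
        where
        p∦w : ¬ p ∥ w
        p∦w p∥w = p∉class (∈-toSubset⁺ (class? y) (inj₂ (trans p∥w (I∥y w∈I))))
        ⁅p⁆∪I⊆⁅p,w⁆ : ⁅ p ⁆ ∪ I ⊆ ⁅ p ⁆ ∪ ⁅ w ⁆
        ⁅p⁆∪I⊆⁅p,w⁆ {u} u∈ with x∈p∪q⁻ ⁅ p ⁆ I u∈
        ... | inj₁ u∈⁅p⁆ = x∈p∪q⁺ (inj₁ u∈⁅p⁆)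
        ... | inj₂ u∈I rewrite parallel-in-face⇒≡ I-face u∈I w∈I (trans (I∥y u∈I) (sym (I∥y w∈I))) =
          x∈p∪q⁺ (inj₂ (x∈⁅x⁆ w))

module FlatLattice {m n} (L : FinLattice m) (𝓗 : SimplicialComplex n)
  (br : SimplicialComplex.BooleanRepresentable 𝓗) (f : Fin m → Subset (suc n))
  (f-flat : ∀ x → SimplicialComplex.IsFlat 𝓗 (f x))
  (f-onto : ∀ X → SimplicialComplex.IsFlat 𝓗 X → ∃ λ x → f x ≡ X)
  (f-iso : ∀ x y → (FinLattice._≤_ L x y ⇔ f x ⊆ f y)) where
  open FinLattice L
  open SimplicialComplex 𝓗
  open Complex 𝓗
  open EnumeratedFlats 𝓗 f f-flat f-onto
  open BR br

  ≤⇒⊆ : ∀ {x y} → x ≤ y → f x ⊆ f y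
  ≤⇒⊆ {x} {y} = Equivalence.to (f-iso x y)

  ⊆⇒≤ : ∀ {x y} → f x ⊆ f y → x ≤ y
  ⊆⇒≤ {x} {y} = Equivalence.from (f-iso x y)

  ⊆-antisym⇒≡ : ∀ {x y} → f x ⊆ f y → f y ⊆ f x → x ≡ y
  ⊆-antisym⇒≡ fx⊆fy fy⊆fx = IsLattice.antisym isLattice (⊆⇒≤ fx⊆fy) (⊆⇒≤ fy⊆fx)

  loops⇒bottom : ∀ {x} → (∀ {z} → z ∈ f x → Loop z) → IsBottom x
  loops⇒bottom fx⊆loops y = ⊆⇒≤ (λ z∈fx → fx⊆loops z∈fx y)

  loops-or-nonloop : ∀ x → (∀ {z} → z ∈ f x → Loop z) ⊎ (∃ λ y → y ∈ f x × ¬ Loop y)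
  loops-or-nonloop x with f x ⊆? loops
  ... | yes fx⊆loops = inj₁ (∈-toSubset⁻ loop? ∘ fx⊆loops)
  ... | no  fx⊈loops with ⊈⇒∃∉ fx⊈loops
  ...   | y , y∈fx , y∉loops = inj₂ (y , y∈fx , y∉loops ∘ ∈-toSubset⁺ loop?)

  cl : Fin (suc n) → Fin m
  cl y = proj₁ (f-onto (class y) (class-flat y))

  f-cl : ∀ y → f (cl y) ≡ class y
  f-cl y = proj₂ (f-onto (class y) (class-flat y))

  ∈cl : ∀ y → y ∈ f (cl y)
  ∈cl y = subst (y ∈_) (sym (f-cl y)) (y∈class y)

  ∈cl⇒∥ : ∀ {y z} → z ∈ f (cl y) → ¬ Loop z → z ∥ y
  ∈cl⇒∥ {y} z∈cl = ∈class⇒∥ {y} (subst (_ ∈_) (f-cl y) z∈cl)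

  cl-least : ∀ {x y} → y ∈ f x → cl y ≤ x
  cl-least {x} {y} y∈fx = ⊆⇒≤ cl⊆fx
    where
    cl⊆fx : f (cl y) ⊆ f x
    cl⊆fx {z} z∈cl with ∈-toSubset⁻ (class? y) (subst (z ∈_) (f-cl y) z∈cl)
    ... | inj₁ z-loop = z-loop x
    ... | inj₂ z∥y    = ∥-flat (f-flat x) (sym z∥y) y∈fx

  cl-atom : ∀ {y} → ¬ Loop y → IsAtom (cl y)
  cl-atom {y} y-nonloop = cl-nonbottom , below-cl
    where
    cl-nonbottom : ¬ IsBottom (cl y)
    cl-nonbottom cl-bottom = y-nonloop (λ x → ≤⇒⊆ (cl-bottom x) (∈cl y))
    below-cl : ∀ x → x ≤ cl y → x ≡ cl y ⊎ IsBottom x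
    below-cl x x≤cl with loops-or-nonloop x
    ... | inj₁ fx⊆loops = inj₂ (loops⇒bottom fx⊆loops)
    ... | inj₂ (z , z∈fx , z-nonloop) = inj₁ (⊆-antisym⇒≡ (≤⇒⊆ x≤cl) (≤⇒⊆ (cl-least y∈fx)))
      where
      y∈fx : y ∈ f x
      y∈fx = ∥-flat (f-flat x) (∈cl⇒∥ (≤⇒⊆ x≤cl z∈fx) z-nonloop) z∈fx

  atom-nonloop : ∀ {a} → IsAtom a → ∃ λ y → y ∈ f a × ¬ Loop y
  atom-nonloop {a} (a-nonbottom , _) with loops-or-nonloop a
  ... | inj₁ fa⊆loops = ⊥-elim (a-nonbottom (loops⇒bottom fa⊆loops))
  ... | inj₂ y        = y

  atom≡cl : ∀ {a y} → IsAtom a → y ∈ f a → ¬ Loop y → a ≡ cl y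
  atom≡cl (_ , below-a) y∈fa y-nonloop with below-a _ (cl-least y∈fa)
  ... | inj₁ cl≡a       = sym cl≡a
  ... | inj₂ cl-bottom = ⊥-elim (proj₁ (cl-atom y-nonloop) cl-bottom)

  module Atoms (As : Subset m) (As-atoms : IsAtomSet As) where

    ∈As : ∀ {a} → IsAtom a → a ∈ As
    ∈As = Equivalence.from (As-atoms _)

    ∈As⇒atom : ∀ {a} → a ∈ As → IsAtom a
    ∈As⇒atom = Equivalence.to (As-atoms _)

    atom? : ∀ x a → Dec (a ∈ As × f a ⊆ f x)
    atom? x a = a ∈? As ×-dec f a ⊆? f x

    atomsBelow : Fin m → Subset m
    atomsBelow x = toSubset (atom? x)

    atomsBelow-atoms : ∀ x {a} → a ∈ atomsBelow x → IsAtom a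
    atomsBelow-atoms x a∈ = ∈As⇒atom (proj₁ (∈-toSubset⁻ (atom? x) a∈))

    atomsBelow-iso : ∀ x y → (x ≤ y ⇔ atomsBelow x ⊆ atomsBelow y)
    atomsBelow-iso x y = mk⇔ mono reflect
      where
      mono : x ≤ y → atomsBelow x ⊆ atomsBelow y
      mono x≤y a∈ with ∈-toSubset⁻ (atom? x) a∈
      ... | a∈As , fa⊆fx = ∈-toSubset⁺ (atom? y) (a∈As , λ z∈fa → ≤⇒⊆ x≤y (fa⊆fx z∈fa))
      reflect : atomsBelow x ⊆ atomsBelow y → x ≤ y
      reflect below⊆ = ⊆⇒≤ fx⊆fy
        where
        fx⊆fy : f x ⊆ f y
        fx⊆fy {z} z∈fx with loop? z
        ... | yes z-loop   = z-loop y
        ... | no z-nonloop =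
          proj₂ (∈-toSubset⁻ (atom? y) (below⊆ (∈-toSubset⁺ (atom? x) cl-below-x))) (∈cl z)
          where
          cl-below-x : cl z ∈ As × f (cl z) ⊆ f x
          cl-below-x = ∈As (cl-atom z-nonloop) , ≤⇒⊆ (cl-least z∈fx)

    module _ {h} (c : Fin (suc h) → Fin m) (c-chain : IsChain h c) (∣As∣≡h : ∣ As ∣ ≡ h) where

      F : Fin (suc h) → Subset (suc n)
      F i = f (c i)

      F-flat : ∀ i → IsFlat (F i)
      F-flat i = f-flat (c i)

      F-step : ∀ i → F (inject₁ i) ⊆ F (suc i)
      F-step i = ≤⇒⊆ (proj₁ (c-chain i))

      entering-point : ∀ i → ∃ λ z → Enters F i z
      entering-point i =
        ⊈⇒∃∉ {p = F (suc i)} (λ F⊆ → proj₂ (c-chain i) (⊆-antisym⇒≡ (F-step i) F⊆))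

      new : Fin h → Fin (suc n)
      new i = proj₁ (entering-point i)

      new-enters : ∀ i → Enters F i (new i)
      new-enters i = proj₂ (entering-point i)

      entering-nonloop : ∀ {i z} → Enters F i z → ¬ Loop z
      entering-nonloop (_ , z∉) z-loop = z∉ (z-loop _)

      entering-together : ∀ {i j z w} → Enters F i z → Enters F j w → z ∥ w → i ≡ j
      entering-together = parallel-enter-together F F-flat F-step

      cl-new-injective : Injective _≡_ _≡_ (cl ∘ new)
      cl-new-injective {i} {j} clᵢ≡clⱼ = sym (entering-together (new-enters j) (new-enters i) newⱼ∥newᵢ)
        where
        newⱼ∥newᵢ : new j ∥ new i
        newⱼ∥newᵢ = ∈cl⇒∥ (subst (λ x → new j ∈ f x) (sym clᵢ≡clⱼ) (∈cl (new j)))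
                          (entering-nonloop (new-enters j))

      atom-is-cl-new : ∀ {a} → a ∈ As → ∃ λ i → cl (new i) ≡ a
      atom-is-cl-new {a} a∈As with any? (λ i → cl (new i) ≟ a)
      ... | yes found  = found
      ... | no missing = ⊥-elim (ℕ.<-irrefl (sym ∣As∣≡h) (injective⇒≤∣p∣ ι ι-injective ι∈As))
        where
        ι : Fin (suc h) → Fin m
        ι zero    = a
        ι (suc i) = cl (new i)
        ι-injective : Injective _≡_ _≡_ ι
        ι-injective {zero}  {zero}  _  = refl
        ι-injective {zero}  {suc j} eq = ⊥-elim (missing (j , sym eq))
        ι-injective {suc i} {zero}  eq = ⊥-elim (missing (i , eq))
        ι-injective {suc i} {suc j} eq = cong suc (cl-new-injective eq)
        ι∈As : ∀ i → ι i ∈ As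
        ι∈As zero    = a∈As
        ι∈As (suc i) = ∈As (cl-atom (entering-nonloop (new-enters i)))

      nonloop∥new : ∀ {z} → ¬ Loop z → ∃ λ j → z ∥ new j
      nonloop∥new {z} z-nonloop with atom-is-cl-new (∈As (cl-atom z-nonloop))
      ... | j , clⱼ≡cl = j , ∈cl⇒∥ (subst (λ x → z ∈ f x) (sym clⱼ≡cl) (∈cl z)) z-nonloop

      entering∥new : ∀ {j z} → Enters F j z → z ∥ new j
      entering∥new {z = z} z-enters =
        let i , z∥newᵢ = nonloop∥new (entering-nonloop z-enters)
        in subst (λ k → z ∥ new k) (sym (entering-together z-enters (new-enters i) z∥newᵢ)) z∥newᵢ

      F₀-loops : ∀ {z} → z ∈ F zero → Loop z
      F₀-loops {z} z∈F₀ with loop? z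
      ... | yes z-loop = z-loop
      ... | no z-nonloop =
        let j , z∥newⱼ = nonloop∥new z-nonloop
        in ⊥-elim (proj₂ (new-enters j) (chain-mono F F-step z≤n (∥-flat (F-flat zero) z∥newⱼ z∈F₀)))

      nonloop∈Fₕ : ∀ {z} → ¬ Loop z → z ∈ F (fromℕ h)
      nonloop∈Fₕ z-nonloop =
        let j , z∥newⱼ = nonloop∥new z-nonloop
        in ∥-flat (F-flat (fromℕ h)) (sym z∥newⱼ)
                  (chain-mono F F-step (≤fromℕ (suc j)) (proj₁ (new-enters j)))

      independent⇒face : ∀ X → (∀ {z} → z ∈ X → ¬ Loop z) →
        (∀ {p q} → p ∈ X → q ∈ X → p ∥ q → p ≡ q) → H X
      independent⇒face X nonloops independent =
        downClosed _ X (λ z∈X → x∈p∩q⁺ (z∈X , nonloop∈Fₕ (nonloops z∈X)))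
          (face-along-flat-chain F F-flat X face₀ one-per-step (fromℕ h))
        where
        face₀ : H (X ∩ F zero)
        face₀ = downClosed _ _ X∩F₀⊆∅ ∅-face
          where
          X∩F₀⊆∅ : X ∩ F zero ⊆ ∅
          X∩F₀⊆∅ z∈ = let z∈X , z∈F₀ = x∈p∩q⁻ X _ z∈ in ⊥-elim (nonloops z∈X (F₀-loops z∈F₀))
        one-per-step : ∀ j {p q} → p ∈ X → q ∈ X → Enters F j p → Enters F j q → p ≡ q
        one-per-step j p∈X q∈X p-enters q-enters =
          independent p∈X q∈X (trans (entering∥new p-enters) (sym (entering∥new q-enters)))

      span? : ∀ S z → Dec (Loop z ⊎ ∃ λ a → a ∈ S × z ∈ f a)
      span? S z = loop? z ⊎-dec any? (λ a → a ∈? S ×-dec z ∈? f a)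

      span : Subset m → Subset (suc n)
      span S = toSubset (span? S)

      span-flat : ∀ S → IsFlat (span S)
      span-flat S I I-face I⊆span p p∉span = independent⇒face (⁅ p ⁆ ∪ I) nonloops independent
        where
        p∦I : ∀ {w} → w ∈ I → ¬ p ∥ w
        p∦I w∈I p∥w with ∈-toSubset⁻ (span? S) (I⊆span w∈I)
        ... | inj₁ w-loop = loop∉face I-face w∈I w-loop
        ... | inj₂ (a , a∈S , w∈fa) =
          p∉span (∈-toSubset⁺ (span? S) (inj₂ (a , a∈S , ∥-flat (f-flat a) (sym p∥w) w∈fa)))
        nonloops : ∀ {z} → z ∈ ⁅ p ⁆ ∪ I → ¬ Loop z
        nonloops z∈ with x∈⁅y⁆∪p⁻ I z∈
        ... | inj₁ refl = p∉span ∘ ∈-toSubset⁺ (span? S) ∘ inj₁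
        ... | inj₂ z∈I  = loop∉face I-face z∈I
        independent : ∀ {u v} → u ∈ ⁅ p ⁆ ∪ I → v ∈ ⁅ p ⁆ ∪ I → u ∥ v → u ≡ v
        independent u∈ v∈ u∥v with x∈⁅y⁆∪p⁻ I u∈ | x∈⁅y⁆∪p⁻ I v∈
        ... | inj₁ refl | inj₁ refl = refl
        ... | inj₁ refl | inj₂ v∈I  = ⊥-elim (p∦I v∈I u∥v)
        ... | inj₂ u∈I  | inj₁ refl = ⊥-elim (p∦I u∈I (sym u∥v))
        ... | inj₂ u∈I  | inj₂ v∈I  = parallel-in-face⇒≡ I-face u∈I v∈I u∥v

      atomsBelow-onto : ∀ S → (∀ {a} → a ∈ S → IsAtom a) → ∃ λ x → atomsBelow x ≡ S
      atomsBelow-onto S S-atoms = onto (f-onto (span S) (span-flat S))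
        where
        onto : (∃ λ x → f x ≡ span S) → ∃ λ x → atomsBelow x ≡ S
        onto (x , fx≡span) = x , ⊆-antisym below⊆S S⊆below
          where
          below⊆S : atomsBelow x ⊆ S
          below⊆S a∈ with ∈-toSubset⁻ (atom? x) a∈
          ... | a∈As , fa⊆fx with atom-nonloop (∈As⇒atom a∈As)
          ...   | y , y∈fa , y-nonloop with ∈-toSubset⁻ (span? S) (subst (y ∈_) fx≡span (fa⊆fx y∈fa))
          ...     | inj₁ y-loop = ⊥-elim (y-nonloop y-loop)
          ...     | inj₂ (b , b∈S , y∈fb) = subst (_∈ S) (trans (atom≡cl (S-atoms b∈S) y∈fb y-nonloop)
                      (sym (atom≡cl (∈As⇒atom a∈As) y∈fa y-nonloop))) b∈S
          S⊆below : S ⊆ atomsBelow x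
          S⊆below {a} a∈S = ∈-toSubset⁺ (atom? x) (∈As (S-atoms a∈S) , λ z∈fa →
            subst (_ ∈_) (sym fx≡span) (∈-toSubset⁺ (span? S) (inj₂ (a , a∈S , z∈fa))))

      powersetOfAtoms : IsoToPowersetOfAtoms
      powersetOfAtoms = atomsBelow , atomsBelow-atoms , atomsBelow-onto , atomsBelow-iso

flatsOfBR⇒powersetOfAtoms : ∀ {m h} (L : FinLattice m) → (∃ λ c → FinLattice.IsChain L h c) →
  FinLattice.NumAtoms L h → IsoToFlatsOfBR L → FinLattice.IsoToPowersetOfAtoms L
flatsOfBR⇒powersetOfAtoms L (c , c-chain) (As , As-atoms , ∣As∣≡h)
                          (_ , 𝓗 , br , f , f-flat , f-onto , f-iso) = powersetOfAtoms c c-chain ∣As∣≡h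
  where open FlatLattice.Atoms L 𝓗 br f f-flat f-onto f-iso As As-atoms

proposition5p4 : ∀ (m : ℕ) (L : FinLattice m) →
    (∃ λ h → FinLattice.Height L h × FinLattice.NumAtoms L h) →
    (IsoToFlatsOfBR L ⇔ FinLattice.IsoToPowersetOfAtoms L)
proposition5p4 m L (h , (chain , _) , numAtoms@(As , As-atoms , _)) =
  mk⇔ (flatsOfBR⇒powersetOfAtoms L chain numAtoms) (powersetOfAtoms⇒flatsOfBR L As As-atoms)
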